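{- Let $q$ be a positive integer and let $S\subseteq[q]^2$ be regular. Then $V_x(S)\cdot V_y(S)\le|S|^3$.
   Context: A set $S\subseteq[q]^2$ is regular if there are positive integers $a,b$ such that: - for all $i\in[q]$, $|\{j\in[q]:(i,j)\in S\}|$ is $a$ or $0$; - for all $j\in[q]$, $|\{i\in[q]:(i,j)\in S\}|$ is $b$ or $0$. Also $V_x(S)=\sum_{i\in[q]}|\{j:(i,j)\in S\}|^2$ and $V_y(S)=\sum_{j\in[q]}|\{i:(i,j)\in S\}|^2$. -}

module Defs where

open import Data.Nat using (ℕ; zero; suc; _+_; _*_; _^_; _>_)
open import Data.Bool using (Bool; true; false)
open import Data.Fin using (Fin)
open import Data.List using (List; map; allFin)
open import Data.Nat.ListAction using (sum)
open import Data.Product using (_×_; ∃-syntax)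
open import Data.Sum using (_⊎_)
open import Relation.Binary.PropositionalEquality using (_≡_)

-- A subset S of [q]^2, given by its (decidable) characteristic function.
Subset2 : ℕ → Set
Subset2 q = Fin q → Fin q → Bool

𝟙 : Bool → ℕ
𝟙 true  = 1
𝟙 false = 0

Σ[_]_ : (q : ℕ) → (Fin q → ℕ) → ℕ
Σ[ q ] f = sum (map f (allFin q))

rowCount : ∀ {q} → Subset2 q → Fin q → ℕ
rowCount {q} S i = Σ[ q ] (λ j → 𝟙 (S i j))

colCount : ∀ {q} → Subset2 q → Fin q → ℕ
colCount {q} S j = Σ[ q ] (λ i → 𝟙 (S i j))

card : ∀ {q} → Subset2 q → ℕ
card {q} S = Σ[ q ] (λ i → rowCount S i)

Vx : ∀ {q} → Subset2 q → ℕ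
Vx {q} S = Σ[ q ] (λ i → rowCount S i ^ 2)

Vy : ∀ {q} → Subset2 q → ℕ
Vy {q} S = Σ[ q ] (λ j → colCount S j ^ 2)

Regular : ∀ {q} → Subset2 q → Set
Regular {q} S =
  ∃[ a ] ∃[ b ] (a > 0 × b > 0 ×
    ((i : Fin q) → rowCount S i ≡ a ⊎ rowCount S i ≡ 0) ×
    ((j : Fin q) → colCount S j ≡ b ⊎ colCount S j ≡ 0))

{-# OPTIONS --safe #-}
module Submission where

-- If every row of S has either a or 0 points, then the points of any column
-- lie in full rows, so a·|column| ≤ |S|. Hence Vx = a·|S| and
-- a·Vy = Σⱼ a·cⱼ² ≤ Σⱼ |S|·cⱼ = |S|², and multiplying gives Vx·Vy ≤ |S|³.

open import Defs
open import Data.Nat using (ℕ; zero; suc; _+_; _*_; _^_; _≤_; _>_; z≤n)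
open import Data.Nat.Properties
open import Data.Bool using (true; false)
open import Data.Fin using (Fin; zero; suc)
open import Data.List using (tabulate)
open import Data.List.Properties using (map-tabulate)
import Data.Nat.ListAction as ListAction
open import Data.Sum using (_⊎_; inj₁; inj₂)
open import Data.Product using (_,_)
open import Data.Vec.Functional using (Vector)
open import Function using (id)
open import Relation.Binary.PropositionalEquality
open import Algebra.Properties.Semiring.Sum +-*-semiring
  using (sum; sum-syntax; sum-cong-≗; ∑-comm; *-distribˡ-sum)

sum-tabulate : ∀ {n} (f : Vector ℕ n) → ListAction.sum (tabulate f) ≡ sum f
sum-tabulate {zero}  f = refl
sum-tabulate {suc n} f = cong (f zero +_) (sum-tabulate (λ i → f (suc i)))

Σ≡sum : ∀ q (f : Vector ℕ q) → Σ[ q ] f ≡ sum f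
Σ≡sum q f = trans (cong ListAction.sum (map-tabulate id f)) (sum-tabulate f)

sum-mono-≤ : ∀ {n} {f g : Vector ℕ n} → (∀ i → f i ≤ g i) → sum f ≤ sum g
sum-mono-≤ {zero}  f≤g = z≤n
sum-mono-≤ {suc n} f≤g = +-mono-≤ (f≤g zero) (sum-mono-≤ (λ i → f≤g (suc i)))

≤sum : ∀ {n} (f : Vector ℕ n) i → f i ≤ sum f
≤sum f zero    = m≤m+n (f zero) _
≤sum f (suc i) = ≤-trans (≤sum (λ k → f (suc k)) i) (m≤n+m _ (f zero))

≡⊎≡0⇒^2≡* : ∀ {a x} → x ≡ a ⊎ x ≡ 0 → x ^ 2 ≡ a * x
≡⊎≡0⇒^2≡* {a} (inj₁ refl) = cong (a *_) (*-identityʳ a)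
≡⊎≡0⇒^2≡* {a} (inj₂ refl) = sym (*-zeroʳ a)

RowRegular : ∀ {q} → ℕ → Subset2 q → Set
RowRegular {q} a S = (i : Fin q) → rowCount S i ≡ a ⊎ rowCount S i ≡ 0

module _ {q : ℕ} (S : Subset2 q) where

  card≡Σ-colCount : card S ≡ Σ[ q ] colCount S
  card≡Σ-colCount = begin
    card S                                  ≡⟨ Σ≡sum q (rowCount S) ⟩
    ∑[ i < q ] rowCount S i                 ≡⟨ sum-cong-≗ (λ i → Σ≡sum q (λ j → 𝟙 (S i j))) ⟩
    ∑[ i < q ] ∑[ j < q ] 𝟙 (S i j)         ≡⟨ ∑-comm (λ i j → 𝟙 (S i j)) ⟩
    ∑[ j < q ] ∑[ i < q ] 𝟙 (S i j)         ≡⟨ sum-cong-≗ (λ j → Σ≡sum q (λ i → 𝟙 (S i j))) ⟨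
    ∑[ j < q ] colCount S j                 ≡⟨ Σ≡sum q (colCount S) ⟨
    Σ[ q ] colCount S                       ∎
    where open ≡-Reasoning

  1≤rowCount : ∀ {i j} → S i j ≡ true → 1 ≤ rowCount S i
  1≤rowCount {i} {j} Sij = begin
    1                       ≡⟨ cong 𝟙 Sij ⟨
    𝟙 (S i j)               ≤⟨ ≤sum (λ k → 𝟙 (S i k)) j ⟩
    ∑[ k < q ] 𝟙 (S i k)    ≡⟨ Σ≡sum q (λ k → 𝟙 (S i k)) ⟨
    rowCount S i            ∎
    where open ≤-Reasoning

  module _ {a : ℕ} (rows : RowRegular a S) where

    Vx≡a*card : Vx S ≡ a * card S
    Vx≡a*card = begin
      Vx S                           ≡⟨ Σ≡sum q (λ i → rowCount S i ^ 2) ⟩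
      ∑[ i < q ] (rowCount S i ^ 2)  ≡⟨ sum-cong-≗ (λ i → ≡⊎≡0⇒^2≡* (rows i)) ⟩
      ∑[ i < q ] (a * rowCount S i)  ≡⟨ *-distribˡ-sum a (rowCount S) ⟨
      a * ∑[ i < q ] rowCount S i    ≡⟨ cong (a *_) (Σ≡sum q (rowCount S)) ⟨
      a * card S                     ∎
      where open ≡-Reasoning

    a*𝟙≤rowCount : ∀ i j → a * 𝟙 (S i j) ≤ rowCount S i
    a*𝟙≤rowCount i j with S i j in Sij
    ... | false = subst (_≤ rowCount S i) (sym (*-zeroʳ a)) z≤n
    ... | true with rows i
    ...   | inj₁ rᵢ≡a = ≤-reflexive (trans (*-identityʳ a) (sym rᵢ≡a))
    ...   | inj₂ rᵢ≡0 with () ← subst (1 ≤_) rᵢ≡0 (1≤rowCount Sij)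

    a*colCount≤card : ∀ j → a * colCount S j ≤ card S
    a*colCount≤card j = begin
      a * colCount S j            ≡⟨ cong (a *_) (Σ≡sum q (λ i → 𝟙 (S i j))) ⟩
      a * ∑[ i < q ] 𝟙 (S i j)    ≡⟨ *-distribˡ-sum a (λ i → 𝟙 (S i j)) ⟩
      ∑[ i < q ] (a * 𝟙 (S i j))  ≤⟨ sum-mono-≤ (λ i → a*𝟙≤rowCount i j) ⟩
      ∑[ i < q ] rowCount S i     ≡⟨ Σ≡sum q (rowCount S) ⟨
      card S                      ∎
      where open ≤-Reasoning

    a*Vy≤card^2 : a * Vy S ≤ card S ^ 2
    a*Vy≤card^2 = begin
      a * Vy S                            ≡⟨ cong (a *_) (Σ≡sum q (λ j → colCount S j ^ 2)) ⟩
      a * ∑[ j < q ] (colCount S j ^ 2)   ≡⟨ *-distribˡ-sum a (λ j → colCount S j ^ 2) ⟩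
      ∑[ j < q ] (a * colCount S j ^ 2)   ≤⟨ sum-mono-≤ a*colCount^2≤card*colCount ⟩
      ∑[ j < q ] (card S * colCount S j)  ≡⟨ *-distribˡ-sum (card S) (colCount S) ⟨
      card S * ∑[ j < q ] colCount S j    ≡⟨ cong (card S *_) (Σ≡sum q (colCount S)) ⟨
      card S * Σ[ q ] colCount S          ≡⟨ cong (card S *_) card≡Σ-colCount ⟨
      card S * card S                     ≡⟨ cong (card S *_) (*-identityʳ (card S)) ⟨
      card S ^ 2                          ∎
      where
      open ≤-Reasoning
      a*colCount^2≤card*colCount : ∀ j → a * colCount S j ^ 2 ≤ card S * colCount S j
      a*colCount^2≤card*colCount j = begin
        a * colCount S j ^ 2  ≡⟨ cong (λ t → a * (c * t)) (*-identityʳ c) ⟩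
        a * (c * c)           ≡⟨ *-assoc a c c ⟨
        a * c * c             ≤⟨ *-monoˡ-≤ c (a*colCount≤card j) ⟩
        card S * c            ∎
        where c = colCount S j

lemma3p9 : (q : ℕ) → q > 0 → (S : Subset2 q) → Regular S →
    Vx S * Vy S ≤ card S ^ 3
lemma3p9 q _ S (a , _ , _ , _ , rows , _) = begin
  Vx S * Vy S          ≡⟨ cong (_* Vy S) (Vx≡a*card S rows) ⟩
  a * card S * Vy S    ≡⟨ cong (_* Vy S) (*-comm a (card S)) ⟩
  card S * a * Vy S    ≡⟨ *-assoc (card S) a (Vy S) ⟩
  card S * (a * Vy S)  ≤⟨ *-monoʳ-≤ (card S) (a*Vy≤card^2 S rows) ⟩
  card S ^ 3           ∎
  where open ≤-Reasoning
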